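{- In each of the two deduction systems DBL and DBL$_\ast$, for all formulas $\phi,\psi\in\mathcal{L}$: $(\psi|\phi)\wedge\phi\equiv\phi\wedge\psi$.
   Context: Fix a finite set $\Theta$ of atomic propositions and a distinguished $\theta_1\in\Theta$. The language $\mathcal{L}$ is the smallest set containing $\Theta$ such that $\neg\phi$, $\phi\rightarrow\psi$ and $(\psi|\phi)$ belong to $\mathcal{L}$ whenever $\phi,\psi\in\mathcal{L}$. Abbreviations: $\phi\vee\psi:=\neg\phi\rightarrow\psi$, $\phi\wedge\psi:=\neg(\neg\phi\vee\neg\psi)$, $\phi\leftrightarrow\psi:=(\phi\rightarrow\psi)\wedge(\psi\rightarrow\phi)$, $\psi\times\phi:=(\psi|\phi)\leftrightarrow\psi$, $\top:=\theta_1\rightarrow\theta_1$, $\bot:=\neg\top$. A sequent is a pair of finite (possibly empty) sequences $\Gamma,\Delta$ of formulas of $\mathcal{L}$, written $\Gamma\vdash\Delta$; "$\Gamma,\Delta$" denotes concatenation and $\{\Gamma\}$ the set of entries of $\Gamma$. The systems DBL and DBL$_\ast$ are the smallest sets of sequents $X$ satisfying, for all $\phi,\psi,\eta\in\mathcal{L}$ and finite sequences $\Gamma,\Delta,\Lambda,\Sigma$: (CUT) if $\Gamma\vdash\Delta,\phi$ and $\Lambda,\phi\vdash\Sigma$ are in $X$ then $\Gamma,\Lambda\vdash\Delta,\Sigma$ is in $X$; (STRUCT) if $\{\Gamma\}\subset\{\Lambda\}\cup\{\top\}$, $\{\Delta\}\subset\{\Sigma\}\cup\{\bot\}$ and $\Gamma\vdash\Delta$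 is in $X$ then $\Lambda\vdash\Sigma$ is in $X$; (modus ponens) $\phi,\phi\rightarrow\psi\vdash\psi$; (c1) $\vdash\phi\rightarrow(\psi\rightarrow\phi)$; (c2) $\vdash(\eta\rightarrow(\phi\rightarrow\psi))\rightarrow((\eta\rightarrow\phi)\rightarrow(\eta\rightarrow\psi))$; (c3) $\vdash(\neg\phi\rightarrow\neg\psi)\rightarrow((\neg\phi\rightarrow\psi)\rightarrow\phi)$; (b1) $\phi\rightarrow\psi\vdash\neg\phi,(\psi|\phi)$; (b2) $\vdash(\psi\rightarrow\eta|\phi)\rightarrow((\psi|\phi)\rightarrow(\eta|\phi))$; (b3) $\vdash(\psi|\phi)\rightarrow(\phi\rightarrow\psi)$; (b4) $\vdash\neg(\neg\psi|\phi)\leftrightarrow(\psi|\phi)$. DBL additionally contains (b5) $\psi\times\phi\vdash\phi\times\psi$. DBL$_\ast$ instead additionally contains (b5.weak.A) $\psi\times\neg\phi\vdash\psi\times\phi$ and $\psi\times\phi\vdash\psi\times\neg\phi$, and (b5.weak.B) $\psi\leftrightarrow\eta\vdash(\phi|\psi)\leftrightarrow(\phi|\eta)$. A sequent is derivable if it belongs to the system; $\phi\equiv\psi$ means that $\vdash\phi\leftrightarrow\psi$ is derivable. -}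

module Defs where

open import Data.Nat using (ℕ; suc)
open import Data.Fin using (Fin; zero)
open import Data.List using (List; []; _∷_; _++_; [_])
open import Data.List.Membership.Propositional using (_∈_)
open import Data.Sum using (_⊎_)
open import Relation.Binary.PropositionalEquality using (_≡_)

-- The finite set Θ of atomic propositions is Fin (suc n) (nonempty, since it
-- contains θ₁); the distinguished atom θ₁ is `zero`.
module Logic (n : ℕ) where

  Atom : Set
  Atom = Fin (suc n)

  θ₁ : Atom
  θ₁ = zero

  infixr 5 _⇒_
  data Form : Set where
    atom : Atom → Form
    ¬'_  : Form → Form
    _⇒_  : Form → Form → Form
    ⟨_∣_⟩ : Form → Form → Form

  _∨'_ : Form → Form → Form
  φ ∨' ψ = (¬' φ) ⇒ ψ

  _∧'_ : Form → Form → Form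
  φ ∧' ψ = ¬' ((¬' φ) ∨' (¬' ψ))

  _⇔_ : Form → Form → Form
  φ ⇔ ψ = (φ ⇒ ψ) ∧' (ψ ⇒ φ)

  _×'_ : Form → Form → Form
  ψ ×' φ = ⟨ ψ ∣ φ ⟩ ⇔ ψ

  ⊤' : Form
  ⊤' = atom θ₁ ⇒ atom θ₁

  ⊥' : Form
  ⊥' = ¬' ⊤'

  data System : Set where
    DBL DBL* : System

  data _⊢[_]_ : List Form → System → List Form → Set where
    CUT : ∀ {S Γ Δ Λ Σ φ} →
          Γ ⊢[ S ] (Δ ++ [ φ ]) → (Λ ++ [ φ ]) ⊢[ S ] Σ →
          (Γ ++ Λ) ⊢[ S ] (Δ ++ Σ)
    STRUCT : ∀ {S Γ Δ Λ Σ} →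
          (∀ {x} → x ∈ Γ → x ∈ Λ ⊎ x ≡ ⊤') →
          (∀ {x} → x ∈ Δ → x ∈ Σ ⊎ x ≡ ⊥') →
          Γ ⊢[ S ] Δ → Λ ⊢[ S ] Σ
    MP : ∀ {S φ ψ} → (φ ∷ (φ ⇒ ψ) ∷ []) ⊢[ S ] [ ψ ]
    c1 : ∀ {S φ ψ} → [] ⊢[ S ] [ φ ⇒ (ψ ⇒ φ) ]
    c2 : ∀ {S η φ ψ} →
         [] ⊢[ S ] [ (η ⇒ (φ ⇒ ψ)) ⇒ ((η ⇒ φ) ⇒ (η ⇒ ψ)) ]
    c3 : ∀ {S φ ψ} →
         [] ⊢[ S ] [ ((¬' φ) ⇒ (¬' ψ)) ⇒ (((¬' φ) ⇒ ψ) ⇒ φ) ]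
    b1 : ∀ {S φ ψ} → [ φ ⇒ ψ ] ⊢[ S ] ((¬' φ) ∷ ⟨ ψ ∣ φ ⟩ ∷ [])
    b2 : ∀ {S φ ψ η} →
         [] ⊢[ S ] [ ⟨ ψ ⇒ η ∣ φ ⟩ ⇒ (⟨ ψ ∣ φ ⟩ ⇒ ⟨ η ∣ φ ⟩) ]
    b3 : ∀ {S φ ψ} → [] ⊢[ S ] [ ⟨ ψ ∣ φ ⟩ ⇒ (φ ⇒ ψ) ]
    b4 : ∀ {S φ ψ} → [] ⊢[ S ] [ (¬' ⟨ ¬' ψ ∣ φ ⟩) ⇔ ⟨ ψ ∣ φ ⟩ ]
    b5 : ∀ {φ ψ} → [ ψ ×' φ ] ⊢[ DBL ] [ φ ×' ψ ]
    b5wA₁ : ∀ {φ ψ} → [ ψ ×' (¬' φ) ] ⊢[ DBL* ] [ ψ ×' φ ]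
    b5wA₂ : ∀ {φ ψ} → [ ψ ×' φ ] ⊢[ DBL* ] [ ψ ×' (¬' φ) ]
    b5wB  : ∀ {φ ψ η} → [ ψ ⇔ η ] ⊢[ DBL* ] [ ⟨ φ ∣ ψ ⟩ ⇔ ⟨ φ ∣ η ⟩ ]

  _≡[_]_ : Form → System → Form → Set
  φ ≡[ S ] ψ = [] ⊢[ S ] [ φ ⇔ ψ ]

{-# OPTIONS --safe #-}
-- By b3, (ψ|φ) and φ yield ψ. Conversely,
-- from φ and ψ the conditional (¬ψ|φ) would yield ¬ψ by b3, so ¬(¬ψ|φ) holds,
-- and b4 turns this into (ψ|φ).
module Submission where

open import Defs
open import Data.Nat using (ℕ)
open import Data.List using (List; []; _∷_; [_])
open import Data.List.Membership.Propositional using (_∈_)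
open import Data.List.Relation.Binary.Subset.Propositional using (_⊆_)
open import Data.List.Relation.Unary.Any using (here; there)
open import Relation.Binary.PropositionalEquality using (refl)

module HilbertCalculus (n : ℕ) (S : Logic.System n) where
  open Logic n

  infix  3 ⊢_ _⊩_
  infixl 9 _·_

  ⊢_ : Form → Set
  ⊢ A = [] ⊢[ S ] [ A ]

  ⊢-mp : ∀ {A B} → ⊢ A ⇒ B → ⊢ A → ⊢ B
  -- Cutting MP against A ⇒ B gives the sequent A ⊢ B, which is then cut against A.
  ⊢-mp {A} ⊢A⇒B ⊢A =
    CUT {Γ = []} {Δ = []} {Λ = []} ⊢A (CUT {Γ = []} {Δ = []} {Λ = [ A ]} ⊢A⇒B MP)

  data _⊩_ (Γ : List Form) : Form → Set where
    hyp : ∀ {A} → A ∈ Γ → Γ ⊩ A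
    thm : ∀ {A} → ⊢ A → Γ ⊩ A
    _·_ : ∀ {A B} → Γ ⊩ A ⇒ B → Γ ⊩ A → Γ ⊩ B

  closed : ∀ {A} → [] ⊩ A → ⊢ A
  closed (hyp ())
  closed (thm ⊢A) = ⊢A
  closed (p · q)  = ⊢-mp (closed p) (closed q)

  weaken : ∀ {Γ Δ A} → Γ ⊆ Δ → Γ ⊩ A → Δ ⊩ A
  weaken Γ⊆Δ (hyp A∈Γ) = hyp (Γ⊆Δ A∈Γ)
  weaken Γ⊆Δ (thm ⊢A)  = thm ⊢A
  weaken Γ⊆Δ (p · q)   = weaken Γ⊆Δ p · weaken Γ⊆Δ q

  var₀ : ∀ {Γ A} → A ∷ Γ ⊩ A
  var₀ = hyp (here refl)

  var₁ : ∀ {Γ A B} → B ∷ A ∷ Γ ⊩ A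
  var₁ = hyp (there (here refl))

  ⇒-refl : ∀ {A} → ⊢ A ⇒ A
  ⇒-refl {A} = ⊢-mp (⊢-mp (c2 {η = A} {φ = A ⇒ A} {ψ = A}) c1) (c1 {ψ = A})

  vacuous : ∀ {Γ A B} → Γ ⊩ A → Γ ⊩ B ⇒ A
  vacuous p = thm c1 · p

  deduction : ∀ {Γ A B} → A ∷ Γ ⊩ B → Γ ⊩ A ⇒ B
  deduction (hyp (here refl)) = thm ⇒-refl
  deduction (hyp (there B∈Γ)) = vacuous (hyp B∈Γ)
  deduction (thm ⊢B)          = vacuous (thm ⊢B)
  deduction (p · q)           = thm c2 · deduction p · deduction q

  ⇒-trans : ∀ {Γ A B C} → Γ ⊩ A ⇒ B → Γ ⊩ B ⇒ C → Γ ⊩ A ⇒ C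
  ⇒-trans A⇒B B⇒C = deduction (weaken there B⇒C · (weaken there A⇒B · var₀))

  ex-falso : ∀ {A B} → ⊢ ¬' A ⇒ (A ⇒ B)
  ex-falso {A} {B} = closed (deduction (deduction
    (thm (c3 {φ = B} {ψ = A}) · vacuous var₁ · vacuous var₀)))

  ¬¬-elim : ∀ {A} → ⊢ ¬' ¬' A ⇒ A
  ¬¬-elim {A} = closed (deduction
    (thm (c3 {φ = A} {ψ = ¬' A}) · vacuous var₀ · thm ⇒-refl))

  ¬¬-intro : ∀ {A} → ⊢ A ⇒ ¬' ¬' A
  ¬¬-intro {A} = closed (deduction
    (thm (c3 {φ = ¬' ¬' A} {ψ = A}) · thm ¬¬-elim · vacuous var₀))

  ¬-intro : ∀ {Γ A B} → Γ ⊩ A ⇒ B → Γ ⊩ A ⇒ ¬' B → Γ ⊩ ¬' A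
  ¬-intro {A = A} {B} A⇒B A⇒¬B =
    thm (c3 {φ = ¬' A} {ψ = B}) · ⇒-trans (thm ¬¬-elim) A⇒¬B · ⇒-trans (thm ¬¬-elim) A⇒B

  ∧-intro : ∀ {Γ A B} → Γ ⊩ A → Γ ⊩ B → Γ ⊩ A ∧' B
  ∧-intro ⊩A ⊩B = ¬-intro (vacuous ⊩B) (deduction (var₀ · (thm ¬¬-intro · weaken there ⊩A)))

  ∧-elimˡ : ∀ {Γ A B} → Γ ⊩ A ∧' B → Γ ⊩ A
  ∧-elimˡ {A = A} {B} A∧B = thm ¬¬-elim · ¬-intro {A = ¬' A}
    (deduction (deduction (thm (ex-falso {A = ¬' A} {B = ¬' B}) · var₀ · var₁)))
    (vacuous A∧B)

  ∧-elimʳ : ∀ {Γ A B} → Γ ⊩ A ∧' B → Γ ⊩ B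
  ∧-elimʳ {A = A} {B} A∧B = thm ¬¬-elim · ¬-intro {A = ¬' B}
    (deduction (vacuous {B = ¬' ¬' A} var₀))
    (vacuous A∧B)

  ⇔-intro : ∀ {Γ A B} → A ∷ Γ ⊩ B → B ∷ Γ ⊩ A → Γ ⊩ A ⇔ B
  ⇔-intro A⊩B B⊩A = ∧-intro (deduction A⊩B) (deduction B⊩A)

  conditional-elim : ∀ {Γ A B} → Γ ⊩ ⟨ B ∣ A ⟩ → Γ ⊩ A → Γ ⊩ B
  conditional-elim B∣A ⊩A = thm b3 · B∣A · ⊩A

  conditional-intro : ∀ {Γ A B} → Γ ⊩ A → Γ ⊩ B → Γ ⊩ ⟨ B ∣ A ⟩
  conditional-intro {A = A} {B} ⊩A ⊩B = ∧-elimˡ (thm (b4 {φ = A} {ψ = B})) · ¬-intro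
    (vacuous ⊩B)
    (deduction (conditional-elim var₀ (weaken there ⊩A)))

  conditional-∧-antecedent : ∀ (φ ψ : Form) → ⊢ (⟨ ψ ∣ φ ⟩ ∧' φ) ⇔ (φ ∧' ψ)
  conditional-∧-antecedent φ ψ = closed (⇔-intro
    (∧-intro (∧-elimʳ var₀) (conditional-elim (∧-elimˡ var₀) (∧-elimʳ var₀)))
    (∧-intro (conditional-intro (∧-elimˡ var₀) (∧-elimʳ var₀)) (∧-elimˡ var₀)))

open Defs.Logic

mainTheorem4 : (n : ℕ) → (S : System n) → (φ ψ : Form n) →
    _≡[_]_ n (_∧'_ n ⟨ ψ ∣ φ ⟩ φ) S (_∧'_ n φ ψ)
mainTheorem4 n S = HilbertCalculus.conditional-∧-antecedent n S
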